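{- Let $G$ be a graph with exactly one full vertex and minimum degree $\delta(G)=1$. If $C(G)=s$ with $s\ge 2$, then $c(G)=s-2$. Further, for a $c$-partition $\pi$ of $G$ of order $s$, the coalition graph satisfies $CG(G,\pi)\cong K_1\cup K_{1,s-2}$.
   Context: All graphs are finite and simple; $n$ is the order of $G$. A full vertex is a vertex of degree $n-1$. A set $S\subseteq V(G)$ is dominating if every vertex outside $S$ has a neighbor in $S$. A coalition consists of two disjoint vertex sets $V_1,V_2$, neither dominating, with $V_1\cup V_2$ dominating; such $V_1,V_2$ are coalition partners. A $c$-partition of $G$ is a partition $\pi=\{V_1,\dots,V_k\}$ of $V(G)$ (its order is $k$) such that every $V_i$ is either a singleton dominating set, or is not dominating but forms a coalition with some other set $V_j\in\pi$. The coalition number $C(G)$ is the maximum order of a $c$-partition of $G$. The coalition count $c(G)$ is the maximum, over all $c$-partitions $\pi$ of $G$, of the number of unordered pairs of distinct sets of $\pi$ forming a coalition. The coalition graph $CG(G,\pi)$ has the sets of $\pi$ as vertices, two being adjacent iff they are coalition partners. $K_1\cup K_{1,s-2}$ is the disjoint union of an isolated vertex and a star with $s-2$ leaves. -}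

module Defs where

open import Data.Nat using (ℕ; zero; suc; _+_; _∸_; _≤_; _<ᵇ_)
open import Data.Bool using (Bool; true; false; _∧_; _∨_; not; if_then_else_)
open import Data.Fin using (Fin; toℕ; _≟_; splitAt)
open import Data.Fin.Patterns using (0F)
open import Data.Sum using (_⊎_; inj₁; inj₂)
open import Data.List using (List; map; allFin)
open import Data.Bool.ListAction using (all; any)
open import Data.Nat.ListAction using (sum)
open import Data.Product using (Σ; ∃; ∃-syntax; _×_; _,_)
open import Relation.Nullary using (¬_; does)
open import Relation.Binary.PropositionalEquality using (_≡_; _≢_)
open import Function.Bundles using (_↔_; Inverse)

record Graph (n : ℕ) : Set where
  field
    adj    : Fin n → Fin n → Bool
    sym    : ∀ u v → adj u v ≡ adj v u
    irrefl : ∀ v → adj v v ≡ false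
open Graph public

deg : ∀ {n} → Graph n → Fin n → ℕ
deg {n} G v = sum (map (λ u → if adj G v u then 1 else 0) (allFin n))

Full : ∀ {n} → Graph n → Fin n → Set
Full {n} G v = deg G v ≡ n ∸ 1

ExactlyOneFullVertex : ∀ {n} → Graph n → Set
ExactlyOneFullVertex G = Σ _ λ v → Full G v × (∀ w → Full G w → w ≡ v)

MinDegree : ∀ {n} → Graph n → ℕ → Set
MinDegree G d = (∀ v → d ≤ deg G v) × (∃[ v ] deg G v ≡ d)

VSet : ℕ → Set
VSet n = Fin n → Bool

_∪ˢ_ : ∀ {n} → VSet n → VSet n → VSet n
(S ∪ˢ T) v = S v ∨ T v

dominating : ∀ {n} → Graph n → VSet n → Bool
dominating {n} G S = all (λ v → S v ∨ any (λ u → S u ∧ adj G u v) (allFin n)) (allFin n)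

disjoint : ∀ {n} → VSet n → VSet n → Bool
disjoint {n} S T = all (λ u → not (S u ∧ T u)) (allFin n)

coalition : ∀ {n} → Graph n → VSet n → VSet n → Bool
coalition G S T =
  disjoint S T ∧ not (dominating G S) ∧ not (dominating G T) ∧ dominating G (S ∪ˢ T)

-- Partitions of V(G) of order k: a surjective labelling f : Fin n → Fin k;
-- the parts are the (nonempty) fibres V_i = f⁻¹(i).

IsPartition : ∀ {n} k → (Fin n → Fin k) → Set
IsPartition {n} k f = ∀ (i : Fin k) → ∃[ u ] f u ≡ i

part : ∀ {n k} → (Fin n → Fin k) → Fin k → VSet n
part f i u = does (f u ≟ i)

IsSingleton : ∀ {n k} → (Fin n → Fin k) → Fin k → Set
IsSingleton f i = ∃[ v ] (∀ u → f u ≡ i → u ≡ v)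

IsCPartition : ∀ {n} → Graph n → (k : ℕ) → (Fin n → Fin k) → Set
IsCPartition G k f =
  IsPartition k f ×
  (∀ (i : Fin k) →
     (IsSingleton f i × dominating G (part f i) ≡ true)
     ⊎ (dominating G (part f i) ≡ false ×
        ∃[ j ] (j ≢ i × coalition G (part f i) (part f j) ≡ true)))

CoalitionNumber : ∀ {n} → Graph n → ℕ → Set
CoalitionNumber G s =
  (Σ (Fin _ → Fin s) λ f → IsCPartition G s f) ×
  (∀ k (f : Fin _ → Fin k) → IsCPartition G k f → k ≤ s)

cgAdj : ∀ {n k} → Graph n → (Fin n → Fin k) → Fin k → Fin k → Bool
cgAdj G f i j = not (does (i ≟ j)) ∧ coalition G (part f i) (part f j)

coalitionPairs : ∀ {n k} → Graph n → (Fin n → Fin k) → ℕ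
coalitionPairs {k = k} G f =
  sum (map (λ i → sum (map (λ j →
    if (toℕ i <ᵇ toℕ j) ∧ coalition G (part f i) (part f j) then 1 else 0)
    (allFin k))) (allFin k))

CoalitionCount : ∀ {n} → Graph n → ℕ → Set
CoalitionCount {n} G m =
  (Σ ℕ λ k → Σ (Fin n → Fin k) λ f → IsCPartition G k f × coalitionPairs G f ≡ m) ×
  (∀ k (f : Fin n → Fin k) → IsCPartition G k f → coalitionPairs G f ≤ m)

_≅_ : ∀ {a b} → (Fin a → Fin a → Bool) → (Fin b → Fin b → Bool) → Set
_≅_ {a} {b} A B = Σ (Fin a ↔ Fin b) λ σ →
  ∀ i j → B (Inverse.to σ i) (Inverse.to σ j) ≡ A i j

K1 : Fin 1 → Fin 1 → Bool
K1 _ _ = false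

isCentre : ∀ {m} → Fin (suc m) → Bool
isCentre i = does (i ≟ 0F)

star : ∀ m → Fin (suc m) → Fin (suc m) → Bool
star m i j = (isCentre i ∧ not (isCentre j)) ∨ (isCentre j ∧ not (isCentre i))

_⊕_ : ∀ {a b} → (Fin a → Fin a → Bool) → (Fin b → Fin b → Bool) →
      Fin (a + b) → Fin (a + b) → Bool
_⊕_ {a} {b} A B i j with splitAt a i | splitAt a j
... | inj₁ x | inj₁ y = A x y
... | inj₂ x | inj₂ y = B x y
... | _      | _      = false

{-# OPTIONS --safe #-}
module Submission where

-- Let x be the full vertex and y a vertex of degree 1.  The only neighbour of y is x, and y ≠ x
-- (otherwise the unique neighbour of x would be full as well).  Hence every dominating set
-- contains x or y, and every set containing x dominates.  In a c-partition the part X of x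
-- therefore dominates and must be the singleton {x}; every other part is non-dominating
-- (a dominating singleton is a full vertex).  Two parts are coalition partners only if neither
-- is X and their union contains y, i.e. one of them is the part Y of y; conversely each part
-- other than X and Y has a partner, which must be Y.  So CG(G, π) is the isolated vertex X
-- together with a star centred at Y with k − 2 leaves, and the number of coalition pairs of a
-- c-partition of order k is k − 2, which is largest when k = C(G).

open import Algebra.Bundles using (CommutativeMonoid)
import Algebra.Properties.CommutativeMonoid.Sum as CommutativeMonoidSum
import Algebra.Properties.CommutativeSemigroup as CommutativeSemigroupProperties
open import Data.Bool using (Bool; true; false; not; _∧_; _∨_; if_then_else_; T)
open import Data.Bool.ListAction using (all; any; and; or)
open import Data.Bool.Properties
  using (T?; T-≡; T-∧; T-∨; ∧-identityʳ; ∧-zeroʳ; ∧-comm; ∨-comm; ∧-commutativeMonoid)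
open import Data.Empty using (⊥-elim)
open import Data.Fin using (Fin; zero; suc; _≟_; _<_; _<?_; punchIn)
open import Data.Fin.Patterns using (0F; 1F)
open import Data.Fin.Permutation using (Permutation′; _⟨$⟩ʳ_; _∘ₚ_; transpose)
import Data.Fin.Permutation.Components as PC
open import Data.Fin.Properties
  using (punchInᵢ≢i; punchIn-punchOut; any?; <⇒≢; <-cmp; <-asym; toℕ<n)
  renaming (<-irrefl to <-irreflᶠ)
import Data.List as List
open import Data.List using (allFin)
open import Data.List.Properties using (map-tabulate; map-cong)
import Data.List.Relation.Unary.All.Properties as All
import Data.List.Relation.Unary.Any.Properties as Any
open import Data.Nat using (ℕ; zero; suc; _+_; _∸_; _≤_; z≤n; s≤s)
import Data.Nat.ListAction as ListAction
open import Data.Nat.Properties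
  using ( +-0-commutativeMonoid; +-identityʳ; m≤m+n; +-monoʳ-≤; <-irrefl; ≤-trans; 1+n≢0
        ; m+n∸m≡n; m+n∸n≡m; m∸[m∸n]≡n; ∸-monoˡ-≤)
open import Data.Product using (∃; ∃-syntax; _×_; _,_; proj₁; proj₂)
import Data.Product as Product
open import Data.Sum using (_⊎_; inj₁; inj₂; [_,_])
import Data.Sum as Sum
open import Defs hiding (sym)
open import Function using (_∘_)
open import Function.Bundles using (_⇔_; mk⇔; Equivalence; Injection)
open import Function.Definitions using (Injective)
open import Function.Properties.Inverse using (↔⇒↣)
open import Relation.Binary.Definitions using (tri<; tri≈; tri>)
open import Relation.Binary.PropositionalEquality
  using (_≡_; _≢_; refl; sym; trans; cong; cong₂; subst; subst₂; module ≡-Reasoning)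
open import Relation.Nullary using (Dec; yes; no; does; ¬_; ¬?; _×-dec_; _⊎-dec_; contradiction)
open import Relation.Nullary.Decidable using (dec-true; dec-false; does-⇔; decidable-stable)

open CommutativeMonoidSum +-0-commutativeMonoid
  using (sum; sum-syntax; ∑-distrib-+; ∑-comm; sum-remove; sum-cong-≗; sum-replicate-zero)
open CommutativeSemigroupProperties (CommutativeMonoid.commutativeSemigroup ∧-commutativeMonoid)
  using (x∙yz≈y∙xz)
open Equivalence using (to; from)

𝟙 : Bool → ℕ
𝟙 b = if b then 1 else 0

count : ∀ {n} → (Fin n → Bool) → ℕ
count {n} p = ∑[ i < n ] 𝟙 (p i)

sum-tabulate : ∀ {n} (h : Fin n → ℕ) → ListAction.sum (List.tabulate h) ≡ sum h
sum-tabulate {zero}  h = refl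
sum-tabulate {suc n} h = cong (h zero +_) (sum-tabulate (h ∘ suc))

sum-map-allFin : ∀ {n} (h : Fin n → ℕ) → ListAction.sum (List.map h (allFin n)) ≡ sum h
sum-map-allFin {n} h =
  trans (cong ListAction.sum (map-tabulate {n = n} (λ i → i) h)) (sum-tabulate h)

sum-zero : ∀ {n} {h : Fin n → ℕ} → (∀ i → h i ≡ 0) → sum h ≡ 0
sum-zero {n} h≗0 = trans (sum-cong-≗ h≗0) (sum-replicate-zero n)

sum-select : ∀ {n} {h : Fin n → ℕ} i → (∀ j → j ≢ i → h j ≡ 0) → sum h ≡ h i
sum-select {suc n} {h} i h≗0 = begin
  sum h                     ≡⟨ sum-remove h ⟩
  h i + sum (h ∘ punchIn i) ≡⟨ cong (h i +_) (sum-zero (λ j → h≗0 _ (punchInᵢ≢i i j))) ⟩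
  h i + 0                   ≡⟨ +-identityʳ (h i) ⟩
  h i                       ∎
  where open ≡-Reasoning

≤-sum : ∀ {n} (h : Fin n → ℕ) i → h i ≤ sum h
≤-sum {suc n} h i = subst (h i ≤_) (sym (sum-remove h)) (m≤m+n (h i) _)

+-≤-sum : ∀ {n} (h : Fin n → ℕ) {i j} → i ≢ j → h i + h j ≤ sum h
+-≤-sum {suc n} h {i} {j} i≢j = subst (h i + h j ≤_) (sym (sum-remove h))
  (+-monoʳ-≤ (h i) (subst (λ l → h l ≤ sum (h ∘ punchIn i)) (punchIn-punchOut i≢j)
    (≤-sum (h ∘ punchIn i) _)))

m+n≡o⇒n≡o∸m : ∀ {m n o} → m + n ≡ o → n ≡ o ∸ m
m+n≡o⇒n≡o∸m {m} {n} refl = sym (m+n∸m≡n m n)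

m+n≡o⇒m≡o∸n : ∀ {m n o} → m + n ≡ o → m ≡ o ∸ n
m+n≡o⇒m≡o∸n {m} {n} refl = sym (m+n∸n≡m m n)

𝟙-not : ∀ b → 𝟙 b + 𝟙 (not b) ≡ 1
𝟙-not true  = refl
𝟙-not false = refl

𝟙-true : ∀ {b} → T b → 𝟙 b ≡ 1
𝟙-true {true} _ = refl

𝟙-false : ∀ {b} → ¬ T b → 𝟙 b ≡ 0
𝟙-false {true}  ¬b = contradiction _ ¬b
𝟙-false {false} _  = refl

𝟙-⊎ : ∀ {A B : Set} (a? : Dec A) (b? : Dec B) → ¬ (A × B) →
      𝟙 (does (a? ⊎-dec b?)) ≡ 𝟙 (does a?) + 𝟙 (does b?)
𝟙-⊎ (yes a) (yes b) ¬a×b = ⊥-elim (¬a×b (a , b))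
𝟙-⊎ (yes a) (no _)  _    = refl
𝟙-⊎ (no _)  _       _    = refl

count-true : ∀ n → count {n} (λ _ → true) ≡ n
count-true zero    = refl
count-true (suc n) = cong suc (count-true n)

count-complement : ∀ {n} (p : Fin n → Bool) → count p + count (not ∘ p) ≡ n
count-complement {n} p = begin
  count p + count (not ∘ p)            ≡⟨ ∑-distrib-+ (𝟙 ∘ p) (𝟙 ∘ not ∘ p) ⟨
  ∑[ i < n ] (𝟙 (p i) + 𝟙 (not (p i))) ≡⟨ sum-cong-≗ (𝟙-not ∘ p) ⟩
  count {n} (λ _ → true)               ≡⟨ count-true n ⟩
  n                                    ∎
  where open ≡-Reasoning

count-≟∧ : ∀ {n} (c : Fin n) b → count (λ i → does (i ≟ c) ∧ b) ≡ 𝟙 b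
count-≟∧ c b = trans (sum-select c off-c) (cong (λ d → 𝟙 (d ∧ b)) (dec-true (c ≟ c) refl))
  where
  off-c : ∀ j → j ≢ c → 𝟙 (does (j ≟ c) ∧ b) ≡ 0
  off-c j j≢c = cong (λ d → 𝟙 (d ∧ b)) (dec-false (j ≟ c) j≢c)

count-≟ : ∀ {n} (c : Fin n) → count (λ i → does (i ≟ c)) ≡ 1
count-≟ c =
  trans (sum-cong-≗ (λ i → cong 𝟙 (sym (∧-identityʳ (does (i ≟ c)))))) (count-≟∧ c true)

count≡1⇒unique : ∀ {n} {p : Fin n → Bool} → count p ≡ 1 →
  ∀ {a b} → T (p a) → T (p b) → a ≡ b
count≡1⇒unique {p = p} count≡1 {a} {b} pa pb with a ≟ b
... | yes a≡b = a≡b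
... | no  a≢b = contradiction (subst (2 ≤_) count≡1 2≤count) (<-irrefl refl)
  where
  2≤count : 2 ≤ count p
  2≤count = subst₂ (λ u v → u + v ≤ count p) (𝟙-true pa) (𝟙-true pb) (+-≤-sum (𝟙 ∘ p) a≢b)

count≢0⇒∃ : ∀ {n} (p : Fin n → Bool) → count p ≢ 0 → ∃ (T ∘ p)
count≢0⇒∃ p count≢0 with any? (T? ∘ p)
... | yes ∃p = ∃p
... | no  ∄p = contradiction (sum-zero (λ i → 𝟙-false (λ pi → ∄p (i , pi)))) count≢0

T-not : ∀ {b} → T (not b) ⇔ (¬ T b)
T-not {true}  = mk⇔ (λ ()) (λ ¬true → ¬true _)
T-not {false} = mk⇔ (λ _ ()) _

T-does : ∀ {A : Set} (a? : Dec A) → T (does a?) ⇔ A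
T-does (yes a) = mk⇔ (λ _ → a) _
T-does (no ¬a) = mk⇔ (λ ()) ¬a

all-allFin⁻ : ∀ {n} (p : Fin n → Bool) → T (all p (allFin n)) → ∀ i → T (p i)
all-allFin⁻ {n} p t = All.tabulate⁻ (All.all⁺ p (allFin n) t)

all-allFin⁺ : ∀ {n} (p : Fin n → Bool) → (∀ i → T (p i)) → T (all p (allFin n))
all-allFin⁺ p h = All.all⁻ p (All.tabulate⁺ h)

any-allFin⁻ : ∀ {n} (p : Fin n → Bool) → T (any p (allFin n)) → ∃ (T ∘ p)
any-allFin⁻ {n} p t = Any.tabulate⁻ (Any.any⁻ p (allFin n) t)

any-allFin⁺ : ∀ {n} (p : Fin n → Bool) i → T (p i) → T (any p (allFin n))
any-allFin⁺ p i pi = Any.any⁺ p (Any.tabulate⁺ i pi)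

-- The edges of K₁ ∪ K_{1,k−2} on Fin k: o is the isolated vertex and c the centre of the star.
StarEdge : ∀ {k} → Fin k → Fin k → Fin k → Fin k → Set
StarEdge o c i j = i ≢ j × i ≢ o × j ≢ o × (i ≡ c ⊎ j ≡ c)

starEdge? : ∀ {k} (o c i j : Fin k) → Dec (StarEdge o c i j)
starEdge? o c i j = ¬? (i ≟ j) ×-dec ¬? (i ≟ o) ×-dec ¬? (j ≟ o) ×-dec (i ≟ c ⊎-dec j ≟ c)

pairCount : ∀ {k} → (Fin k → Fin k → Bool) → ℕ
pairCount {k} A = ∑[ i < k ] count (λ j → does (i <? j) ∧ A i j)

pairCount-cong : ∀ {k} {A B : Fin k → Fin k → Bool} →
  (∀ i j → A i j ≡ B i j) → pairCount A ≡ pairCount B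
pairCount-cong A≡B =
  sum-cong-≗ λ i → sum-cong-≗ λ j → cong (λ b → 𝟙 (does (i <? j) ∧ b)) (A≡B i j)

ordered-starEdge⇔ : ∀ {k} {o c i j : Fin k} → o ≢ c →
  (i < j × StarEdge o c i j) ⇔ (i ≡ c × c < j × j ≢ o ⊎ j ≡ c × i < c × i ≢ o)
ordered-starEdge⇔ {o = o} {c} o≢c = mk⇔ to′ from′
  where
  to′ : ∀ {i j} → i < j × StarEdge o c i j → i ≡ c × c < j × j ≢ o ⊎ j ≡ c × i < c × i ≢ o
  to′ (c<j , _ , _   , j≢o , inj₁ refl) = inj₁ (refl , c<j , j≢o)
  to′ (i<c , _ , i≢o , _   , inj₂ refl) = inj₂ (refl , i<c , i≢o)
  from′ : ∀ {i j} → i ≡ c × c < j × j ≢ o ⊎ j ≡ c × i < c × i ≢ o → i < j × StarEdge o c i j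
  from′ (inj₁ (refl , c<j , j≢o)) = c<j , <⇒≢ c<j , o≢c ∘ sym , j≢o , inj₁ refl
  from′ (inj₂ (refl , i<c , i≢o)) = i<c , <⇒≢ i<c , i≢o , o≢c ∘ sym , inj₂ refl

-- An edge i < j of the star has the centre c either as its smaller end, j being a leaf above c,
-- or as its larger end, i being a leaf below c; every vertex other than o and c is exactly one
-- of a leaf above c and a leaf below c.
pairCount-starEdge : ∀ {k} {o c : Fin k} → o ≢ c →
  pairCount (λ i j → does (starEdge? o c i j)) ≡ k ∸ 2
pairCount-starEdge {k} {o} {c} o≢c = begin
  pairCount (λ i j → does (starEdge? o c i j))
    ≡⟨ sum-cong-≗ (λ i → sum-cong-≗ (split i)) ⟩
  ∑[ i < k ] ∑[ j < k ] (centreSmaller i j + centreLarger i j)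
    ≡⟨ sum-cong-≗ (λ i → ∑-distrib-+ (centreSmaller i) (centreLarger i)) ⟩
  ∑[ i < k ] (sum (centreSmaller i) + sum (centreLarger i))
    ≡⟨ ∑-distrib-+ (sum ∘ centreSmaller) (sum ∘ centreLarger) ⟩
  ∑[ i < k ] sum (centreSmaller i) + ∑[ i < k ] sum (centreLarger i)
    ≡⟨ cong₂ _+_ (∑-comm centreSmaller) (sum-cong-≗ (λ i → count-≟∧ c (leafBelow i))) ⟩
  ∑[ j < k ] ∑[ i < k ] centreSmaller i j + count leafBelow
    ≡⟨ cong (_+ count leafBelow) (sum-cong-≗ (λ j → count-≟∧ c (leafAbove j))) ⟩
  count leafAbove + count leafBelow
    ≡⟨ ∑-distrib-+ (𝟙 ∘ leafAbove) (𝟙 ∘ leafBelow) ⟨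
  ∑[ j < k ] (𝟙 (leafAbove j) + 𝟙 (leafBelow j))
    ≡⟨ sum-cong-≗ merge ⟩
  count (not ∘ centreOrIsolated)
    ≡⟨ m+n≡o⇒n≡o∸m (count-complement centreOrIsolated) ⟩
  k ∸ count centreOrIsolated
    ≡⟨ cong (k ∸_) count-centreOrIsolated ⟩
  k ∸ 2 ∎
  where
  open ≡-Reasoning
  leafAbove leafBelow centreOrIsolated : Fin k → Bool
  leafAbove j        = does (c <? j ×-dec ¬? (j ≟ o))
  leafBelow i        = does (i <? c ×-dec ¬? (i ≟ o))
  centreOrIsolated j = does (j ≟ c ⊎-dec j ≟ o)

  centreSmaller centreLarger : Fin k → Fin k → ℕ
  centreSmaller i j = 𝟙 (does (i ≟ c) ∧ leafAbove j)
  centreLarger  i j = 𝟙 (does (j ≟ c) ∧ leafBelow i)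

  split : ∀ i j →
    𝟙 (does (i <? j) ∧ does (starEdge? o c i j)) ≡ centreSmaller i j + centreLarger i j
  split i j = trans
    (cong 𝟙 (does-⇔ (ordered-starEdge⇔ o≢c) (i <? j ×-dec starEdge? o c i j) (smaller ⊎-dec larger)))
    (𝟙-⊎ smaller larger λ ((_ , c<j , _) , (j≡c , _)) → <-irreflᶠ (sym j≡c) c<j)
    where
    smaller = i ≟ c ×-dec c <? j ×-dec ¬? (j ≟ o)
    larger  = j ≟ c ×-dec i <? c ×-dec ¬? (i ≟ o)

  merge : ∀ j → 𝟙 (leafAbove j) + 𝟙 (leafBelow j) ≡ 𝟙 (not (centreOrIsolated j))
  merge j = trans (sym (𝟙-⊎ above below λ ((c<j , _) , (j<c , _)) → <-asym c<j j<c))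
                  (cong 𝟙 (does-⇔ (mk⇔ to′ from′) (above ⊎-dec below) (¬? (j ≟ c ⊎-dec j ≟ o))))
    where
    above = c <? j ×-dec ¬? (j ≟ o)
    below = j <? c ×-dec ¬? (j ≟ o)
    to′ : c < j × j ≢ o ⊎ j < c × j ≢ o → ¬ (j ≡ c ⊎ j ≡ o)
    to′ (inj₁ (c<j , j≢o)) = [ <⇒≢ c<j ∘ sym , j≢o ]
    to′ (inj₂ (j<c , j≢o)) = [ <⇒≢ j<c , j≢o ]
    from′ : ¬ (j ≡ c ⊎ j ≡ o) → c < j × j ≢ o ⊎ j < c × j ≢ o
    from′ j∉ with <-cmp c j
    ... | tri< c<j _ _ = inj₁ (c<j , j∉ ∘ inj₂)
    ... | tri≈ _ c≡j _ = contradiction (inj₁ (sym c≡j)) j∉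
    ... | tri> _ _ j<c = inj₂ (j<c , j∉ ∘ inj₂)

  count-centreOrIsolated : count centreOrIsolated ≡ 2
  count-centreOrIsolated = begin
    count centreOrIsolated
      ≡⟨ sum-cong-≗ (λ j → 𝟙-⊎ (j ≟ c) (j ≟ o) λ (j≡c , j≡o) → o≢c (trans (sym j≡o) j≡c)) ⟩
    ∑[ j < k ] (𝟙 (does (j ≟ c)) + 𝟙 (does (j ≟ o)))
      ≡⟨ ∑-distrib-+ (λ j → 𝟙 (does (j ≟ c))) (λ j → 𝟙 (does (j ≟ o))) ⟩
    count (λ j → does (j ≟ c)) + count (λ j → does (j ≟ o))
      ≡⟨ cong₂ _+_ (count-≟ c) (count-≟ o) ⟩
    2 ∎

K1⊕star≡starEdge : ∀ m (a b : Fin (2 + m)) → (K1 ⊕ star m) a b ≡ does (starEdge? 0F 1F a b)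
K1⊕star≡starEdge m zero          zero          = refl
K1⊕star≡starEdge m zero          (suc b)       = refl
K1⊕star≡starEdge m (suc a)       zero          = refl
K1⊕star≡starEdge m (suc zero)    (suc zero)    = refl
K1⊕star≡starEdge m (suc zero)    (suc (suc b)) = refl
K1⊕star≡starEdge m (suc (suc a)) (suc zero)    = refl
K1⊕star≡starEdge m (suc (suc a)) (suc (suc b)) = sym (∧-zeroʳ _)

starEdge-injective : ∀ {k l} {σ : Fin k → Fin l} → Injective _≡_ _≡_ σ → ∀ {o c i j} →
  StarEdge (σ o) (σ c) (σ i) (σ j) ⇔ StarEdge o c i j
starEdge-injective {σ = σ} σ-inj = mk⇔
  (λ (σi≢σj , σi≢σo , σj≢σo , σi≡σc⊎σj≡σc) →
     σi≢σj ∘ cong σ , σi≢σo ∘ cong σ , σj≢σo ∘ cong σ , Sum.map σ-inj σ-inj σi≡σc⊎σj≡σc)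
  (λ (i≢j , i≢o , j≢o , i≡c⊎j≡c) →
     i≢j ∘ σ-inj , i≢o ∘ σ-inj , j≢o ∘ σ-inj , Sum.map (cong σ) (cong σ) i≡c⊎j≡c)

transpose-matchˡ : ∀ {n} (i j : Fin n) → PC.transpose i j i ≡ j
transpose-matchˡ i j rewrite dec-true (i ≟ i) refl = refl

transpose-fix : ∀ {n} {i j k : Fin n} → k ≢ i → k ≢ j → PC.transpose i j k ≡ k
transpose-fix {i = i} {j} {k} k≢i k≢j
  rewrite dec-false (k ≟ i) k≢i | dec-false (k ≟ j) k≢j = refl

toFront : ∀ {m} {o c : Fin (2 + m)} → o ≢ c →
  ∃ λ (σ : Permutation′ (2 + m)) → σ ⟨$⟩ʳ o ≡ 0F × σ ⟨$⟩ʳ c ≡ 1F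
toFront {o = o} {c} o≢c = π ∘ₚ ρ , ρ[π[o]]≡0 , transpose-matchˡ (π ⟨$⟩ʳ c) 1F
  where
  π ρ : Permutation′ _
  π = transpose o 0F
  ρ = transpose (π ⟨$⟩ʳ c) 1F
  π[o]≡0 : π ⟨$⟩ʳ o ≡ 0F
  π[o]≡0 = transpose-matchˡ o 0F
  ρ[π[o]]≡0 : ρ ⟨$⟩ʳ (π ⟨$⟩ʳ o) ≡ 0F
  ρ[π[o]]≡0 = trans (cong (ρ ⟨$⟩ʳ_) π[o]≡0)
    (transpose-fix (λ 0≡π[c] → o≢c (Injection.injective (↔⇒↣ π) (trans π[o]≡0 0≡π[c]))) λ ())

≅K1⊕star : ∀ {k} → 2 ≤ k → (A : Fin k → Fin k → Bool) {o c : Fin k} → o ≢ c →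
  (∀ i j → A i j ≡ does (starEdge? o c i j)) → A ≅ (K1 ⊕ star (k ∸ 2))
≅K1⊕star {suc (suc m)} (s≤s (s≤s z≤n)) A {o} {c} o≢c A≡starEdge with toFront o≢c
... | σ , σo≡0 , σc≡1 = σ , λ i j → begin
  (K1 ⊕ star m) (σ ⟨$⟩ʳ i) (σ ⟨$⟩ʳ j)
    ≡⟨ K1⊕star≡starEdge m (σ ⟨$⟩ʳ i) (σ ⟨$⟩ʳ j) ⟩
  does (starEdge? 0F 1F (σ ⟨$⟩ʳ i) (σ ⟨$⟩ʳ j))
    ≡⟨ cong₂ (λ o′ c′ → does (starEdge? o′ c′ (σ ⟨$⟩ʳ i) (σ ⟨$⟩ʳ j))) σo≡0 σc≡1 ⟨
  does (starEdge? (σ ⟨$⟩ʳ o) (σ ⟨$⟩ʳ c) (σ ⟨$⟩ʳ i) (σ ⟨$⟩ʳ j))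
    ≡⟨ does-⇔ (starEdge-injective (Injection.injective (↔⇒↣ σ)))
         (starEdge? (σ ⟨$⟩ʳ o) (σ ⟨$⟩ʳ c) (σ ⟨$⟩ʳ i) (σ ⟨$⟩ʳ j)) (starEdge? o c i j) ⟩
  does (starEdge? o c i j)
    ≡⟨ A≡starEdge i j ⟨
  A i j ∎
  where open ≡-Reasoning

module _ {n} (G : Graph n) where

  not-loop : ∀ {v} → ¬ T (adj G v v)
  not-loop {v} = subst T (irrefl G v)

  adj-sym : ∀ {u v} → T (adj G u v) → T (adj G v u)
  adj-sym {u} {v} = subst T (Graph.sym G u v)

  deg≡count : ∀ v → deg G v ≡ count (adj G v)
  deg≡count v = sum-map-allFin (𝟙 ∘ adj G v)

  full⇔non-adjacent-once : ∀ {v} → Full G v ⇔ count (not ∘ adj G v) ≡ 1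
  full⇔non-adjacent-once {v} = mk⇔
    (λ deg≡n∸1 → begin
      count (not ∘ adj G v)     ≡⟨ m+n≡o⇒n≡o∸m (count-complement (adj G v)) ⟩
      n ∸ count (adj G v)       ≡⟨ cong (n ∸_) (trans (sym (deg≡count v)) deg≡n∸1) ⟩
      n ∸ (n ∸ 1)               ≡⟨ m∸[m∸n]≡n (≤-trans (s≤s z≤n) (toℕ<n v)) ⟩
      1                         ∎)
    (λ non-adjacent-once → begin
      deg G v                   ≡⟨ deg≡count v ⟩
      count (adj G v)           ≡⟨ m+n≡o⇒m≡o∸n (count-complement (adj G v)) ⟩
      n ∸ count (not ∘ adj G v) ≡⟨ cong (n ∸_) non-adjacent-once ⟩
      n ∸ 1                     ∎)
    where open ≡-Reasoning

  full⇒adjacent : ∀ {v} → Full G v → ∀ {u} → u ≢ v → T (adj G v u)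
  full⇒adjacent {v} full-v {u} u≢v = decidable-stable (T? (adj G v u)) λ ¬vu →
    u≢v (count≡1⇒unique (to full⇔non-adjacent-once full-v) (from T-not ¬vu) (from T-not not-loop))

  adjacent⇒full : ∀ {v} → (∀ {u} → u ≢ v → T (adj G v u)) → Full G v
  adjacent⇒full {v} adjacent = from full⇔non-adjacent-once
    (trans (sum-select v λ u u≢v → 𝟙-false λ ¬vu → to T-not ¬vu (adjacent u≢v))
           (𝟙-true (from T-not not-loop)))

  deg≡1⇒unique-neighbour : ∀ {v} → deg G v ≡ 1 →
    ∀ {a b} → T (adj G v a) → T (adj G v b) → a ≡ b
  deg≡1⇒unique-neighbour {v} deg≡1 = count≡1⇒unique (trans (sym (deg≡count v)) deg≡1)

  full∧deg≡1⇒full-neighbour : ∀ {v} → Full G v → deg G v ≡ 1 → ∃[ u ] T (adj G v u) × Full G u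
  full∧deg≡1⇒full-neighbour {v} full-v deg≡1
    with count≢0⇒∃ (adj G v) (λ count≡0 → 1+n≢0 (trans (sym deg≡1) (trans (deg≡count v) count≡0)))
  ... | u , vu = u , vu , adjacent⇒full adjacent-u
    where
    adjacent-u : ∀ {w} → w ≢ u → T (adj G u w)
    adjacent-u {w} w≢u with w ≟ v
    ... | yes refl = adj-sym vu
    ... | no  w≢v  = contradiction (deg≡1⇒unique-neighbour deg≡1 (full⇒adjacent full-v w≢v) vu) w≢u

  Dominates : VSet n → Fin n → Set
  Dominates S v = T (S v) ⊎ ∃[ u ] T (S u) × T (adj G u v)

  dominating⇔ : ∀ {S} → T (dominating G S) ⇔ (∀ v → Dominates S v)
  dominating⇔ = mk⇔
    (λ dom v → Sum.map₂ (Product.map₂ (to T-∧) ∘ any-allFin⁻ _) (to T-∨ (all-allFin⁻ _ dom v)))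
    (λ dominates → all-allFin⁺ _ λ v → from T-∨
      (Sum.map₂ (λ (u , Su , uv) → any-allFin⁺ _ u (from T-∧ (Su , uv))) (dominates v)))

  dominating-singleton⇒full : ∀ {S v} → (∀ {u} → T (S u) → u ≡ v) → T (dominating G S) → Full G v
  dominating-singleton⇒full {S} {v} S⊆v dom =
    adjacent⇒full λ u≢v → adjacent u≢v (to dominating⇔ dom _)
    where
    adjacent : ∀ {u} → u ≢ v → Dominates S u → T (adj G v u)
    adjacent u≢v (inj₁ Su)            = contradiction (S⊆v Su) u≢v
    adjacent _   (inj₂ (w , Sw , wu)) = subst (λ w → T (adj G w _)) (S⊆v Sw) wu

  coalition⁻ : ∀ {S R} → T (coalition G S R) →
    (∀ u → ¬ (T (S u) × T (R u))) × ¬ T (dominating G S) × ¬ T (dominating G R) ×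
    T (dominating G (S ∪ˢ R))
  coalition⁻ coal =
    let disjoint-SR , rest₁ = to T-∧ coal
        ¬dom-S , rest₂      = to T-∧ rest₁
        ¬dom-R , dom-S∪R    = to T-∧ rest₂
    in  (λ u Su×Ru → to T-not (all-allFin⁻ _ disjoint-SR u) (from T-∧ Su×Ru)) ,
        to T-not ¬dom-S , to T-not ¬dom-R , dom-S∪R

  disjoint-comm : ∀ (S R : VSet n) → disjoint S R ≡ disjoint R S
  disjoint-comm S R = cong and (map-cong (λ u → cong not (∧-comm (S u) (R u))) (allFin n))

  dominating-cong : ∀ {S R : VSet n} → (∀ v → S v ≡ R v) → dominating G S ≡ dominating G R
  dominating-cong S≗R = cong and (map-cong (λ v → cong₂ _∨_ (S≗R v)
    (cong or (map-cong (λ u → cong (_∧ adj G u v) (S≗R u)) (allFin n)))) (allFin n))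

  coalition-comm : ∀ (S R : VSet n) → coalition G S R ≡ coalition G R S
  coalition-comm S R = begin
    disjoint S R ∧ not (dominating G S) ∧ not (dominating G R) ∧ dominating G (S ∪ˢ R)
      ≡⟨ cong₂ (λ dis dom → dis ∧ not (dominating G S) ∧ not (dominating G R) ∧ dom)
               (disjoint-comm S R) (dominating-cong (λ v → ∨-comm (S v) (R v))) ⟩
    disjoint R S ∧ not (dominating G S) ∧ not (dominating G R) ∧ dominating G (R ∪ˢ S)
      ≡⟨ cong (disjoint R S ∧_) (x∙yz≈y∙xz (not (dominating G S)) (not (dominating G R)) _) ⟩
    coalition G R S ∎
    where open ≡-Reasoning

  coalitionPairs≡pairCount : ∀ {k} (f : Fin n → Fin k) →
    coalitionPairs G f ≡ pairCount (λ i j → coalition G (part f i) (part f j))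
  coalitionPairs≡pairCount {k} f =
    trans (sum-map-allFin (λ i → ListAction.sum (List.map (ordered-coalition i) (allFin k))))
          (sum-cong-≗ λ i → sum-map-allFin (ordered-coalition i))
    where
    ordered-coalition : Fin k → Fin k → ℕ
    ordered-coalition i j = 𝟙 (does (i <? j) ∧ coalition G (part f i) (part f j))

module UniqueFullVertexWithLeaf
  {n} (G : Graph n) {x y : Fin n}
  (full-x : Full G x) (full⇒x : ∀ w → Full G w → w ≡ x) (deg-y : deg G y ≡ 1) where

  leaf≢full : y ≢ x
  leaf≢full y≡x with full∧deg≡1⇒full-neighbour G full-x (subst (λ v → deg G v ≡ 1) y≡x deg-y)
  ... | u , xu , full-u = not-loop G (subst (T ∘ adj G x) (full⇒x u full-u) xu)

  leaf-neighbour : ∀ {u} → T (adj G y u) → u ≡ x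
  leaf-neighbour yu =
    deg≡1⇒unique-neighbour G deg-y yu (adj-sym G (full⇒adjacent G full-x leaf≢full))

  ∋full⇒dominating : ∀ {S} → T (S x) → T (dominating G S)
  ∋full⇒dominating {S} Sx = from (dominating⇔ G) dominates
    where
    dominates : ∀ v → Dominates G S v
    dominates v with v ≟ x
    ... | yes refl = inj₁ Sx
    ... | no  v≢x  = inj₂ (x , Sx , full⇒adjacent G full-x v≢x)

  dominating⇒∋full⊎leaf : ∀ {S} → T (dominating G S) → T (S x) ⊎ T (S y)
  dominating⇒∋full⊎leaf {S} dom with to (dominating⇔ G) dom y
  ... | inj₁ Sy            = inj₂ Sy
  ... | inj₂ (u , Su , uy) = inj₁ (subst (T ∘ S) (leaf-neighbour (adj-sym G uy)) Su)

  module _ {k} {f : Fin n → Fin k} (cp : IsCPartition G k f) where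

    X Y : Fin k
    X = f x
    Y = f y

    ∈part⁺ : ∀ {i u} → f u ≡ i → T (part f i u)
    ∈part⁺ {i} {u} = from (T-does (f u ≟ i))

    ∈part⁻ : ∀ {i u} → T (part f i u) → f u ≡ i
    ∈part⁻ {i} {u} = to (T-does (f u ≟ i))

    part-X-dominating : T (dominating G (part f X))
    part-X-dominating = ∋full⇒dominating (∈part⁺ refl)

    part-X⊆x : ∀ {u} → f u ≡ X → u ≡ x
    part-X⊆x {u} fu≡X with proj₂ cp X
    ... | inj₁ ((v , ⊆v) , _) = trans (⊆v u fu≡X) (sym (⊆v x refl))
    ... | inj₂ (¬dom , _)     = ⊥-elim (subst T ¬dom part-X-dominating)

    Y≢X : Y ≢ X
    Y≢X = leaf≢full ∘ part-X⊆x

    has-partner : ∀ {i} → i ≢ X → ∃[ j ] T (coalition G (part f i) (part f j))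
    has-partner {i} i≢X with proj₂ cp i
    ... | inj₂ (_ , j , _ , coal) = j , from T-≡ coal
    ... | inj₁ ((v , ⊆v) , dom) with proj₁ cp i
    ...   | u , fu≡i = contradiction (trans (sym fu≡i) (cong f (trans (⊆v u fu≡i) v≡x))) i≢X
      where
      v≡x : v ≡ x
      v≡x = full⇒x v (dominating-singleton⇒full G (⊆v _ ∘ ∈part⁻) (from T-≡ dom))

    coalition⇒starEdge : ∀ {i j} → T (coalition G (part f i) (part f j)) → StarEdge X Y i j
    coalition⇒starEdge {i} {j} coal with coalition⁻ G coal
    ... | disjoint-ij , ¬dom-i , ¬dom-j , dom-i∪j = i≢j , i≢X , j≢X , i≡Y⊎j≡Y
      where
      i≢j : i ≢ j
      i≢j refl with proj₁ cp i
      ... | u , fu≡i = disjoint-ij u (∈part⁺ fu≡i , ∈part⁺ fu≡i)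
      i≢X : i ≢ X
      i≢X refl = ¬dom-i part-X-dominating
      j≢X : j ≢ X
      j≢X refl = ¬dom-j part-X-dominating
      i≡Y⊎j≡Y : i ≡ Y ⊎ j ≡ Y
      i≡Y⊎j≡Y with dominating⇒∋full⊎leaf dom-i∪j
      ... | inj₁ x∈i∪j = ⊥-elim ([ i≢X ∘ sym ∘ ∈part⁻ , j≢X ∘ sym ∘ ∈part⁻ ] (to T-∨ x∈i∪j))
      ... | inj₂ y∈i∪j = Sum.map (sym ∘ ∈part⁻) (sym ∘ ∈part⁻) (to T-∨ y∈i∪j)

    partner-is-Y : ∀ {i} → i ≢ X → i ≢ Y → T (coalition G (part f i) (part f Y))
    partner-is-Y i≢X i≢Y with has-partner i≢X
    ... | j , coal with coalition⇒starEdge coal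
    ...   | _ , _ , _ , inj₁ i≡Y  = contradiction i≡Y i≢Y
    ...   | _ , _ , _ , inj₂ refl = coal

    starEdge⇒coalition : ∀ {i j} → StarEdge X Y i j → T (coalition G (part f i) (part f j))
    starEdge⇒coalition (i≢j , _ , j≢X , inj₁ refl) =
      subst T (coalition-comm G _ _) (partner-is-Y j≢X (i≢j ∘ sym))
    starEdge⇒coalition (i≢j , i≢X , _ , inj₂ refl) = partner-is-Y i≢X i≢j

    coalition≡starEdge : ∀ i j → coalition G (part f i) (part f j) ≡ does (starEdge? X Y i j)
    coalition≡starEdge i j =
      does-⇔ (mk⇔ coalition⇒starEdge starEdge⇒coalition) (T? _) (starEdge? X Y i j)

    cgAdj≡starEdge : ∀ i j → cgAdj G f i j ≡ does (starEdge? X Y i j)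
    cgAdj≡starEdge i j = trans (cong (not (does (i ≟ j)) ∧_) (coalition≡starEdge i j))
      (does-⇔ (mk⇔ proj₂ (λ e → proj₁ e , e))
              (¬? (i ≟ j) ×-dec starEdge? X Y i j) (starEdge? X Y i j))

    coalitionPairs≡k∸2 : coalitionPairs G f ≡ k ∸ 2
    coalitionPairs≡k∸2 = begin
      coalitionPairs G f                                     ≡⟨ coalitionPairs≡pairCount G f ⟩
      pairCount (λ i j → coalition G (part f i) (part f j)) ≡⟨ pairCount-cong coalition≡starEdge ⟩
      pairCount (λ i j → does (starEdge? X Y i j))          ≡⟨ pairCount-starEdge (Y≢X ∘ sym) ⟩
      k ∸ 2                                                  ∎
      where open ≡-Reasoning

mainTheorem5 : ∀ {n} (G : Graph n) (s : ℕ) →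
    ExactlyOneFullVertex G → MinDegree G 1 → CoalitionNumber G s → 2 ≤ s →
    CoalitionCount G (s ∸ 2) ×
    (∀ (f : Fin n → Fin s) → IsCPartition G s f →
    cgAdj G f ≅ (K1 ⊕ star (s ∸ 2)))
mainTheorem5 G s (x , full-x , full⇒x) (_ , y , deg-y) ((f₀ , cp₀) , maximal) 2≤s =
  coalition-count , coalition-graph
  where
  open UniqueFullVertexWithLeaf G full-x full⇒x deg-y

  coalition-count : CoalitionCount G (s ∸ 2)
  coalition-count =
    (s , f₀ , cp₀ , coalitionPairs≡k∸2 cp₀) ,
    λ k f cp → subst (_≤ s ∸ 2) (sym (coalitionPairs≡k∸2 cp)) (∸-monoˡ-≤ 2 (maximal k f cp))

  coalition-graph : ∀ f → IsCPartition G s f → cgAdj G f ≅ (K1 ⊕ star (s ∸ 2))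
  coalition-graph f cp = ≅K1⊕star 2≤s (cgAdj G f) (Y≢X cp ∘ sym) (cgAdj≡starEdge cp)
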